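{- Let $G$ be a finite group, $N$ a normal subgroup of $G$, and let $\Gamma$ be a group endowed with a surjective morphism $\Gamma \rightarrow G$, $\sigma \mapsto \bar\sigma$. Let $A$ be a $\Gamma$-module (written multiplicatively). For every map $\beta : G \rightarrow A$ we have the equality of maps $\Gamma \times G/N \rightarrow A$: \[ \mathrm{d}(\mathrm{AW}^1(\beta)) = \mathrm{AW}^2(\mathrm{d}(\beta)). \]
   Context: For $\beta : G \rightarrow A$, define $\mathrm{AW}^1(\beta) : G/N \rightarrow A$ by $\mathrm{AW}^1(\beta)(\sigma) = \prod_{n \in N} \beta(n\tilde\sigma)/\beta(n)$, where $\tilde\sigma \in G$ is any lift of $\sigma$. For a map $\alpha : \Gamma \times G \rightarrow A$, define $\mathrm{AW}^2(\alpha) : \Gamma \times G/N \rightarrow A$ by $\mathrm{AW}^2(\alpha)(\sigma,\tau) = \prod_{n \in N} \alpha(\sigma, n\tilde\tau)/\alpha(\sigma, n)$, where $\tilde\tau \in G$ is any lift of $\tau \in G/N$ (both are independent of the lifts). Differentials: for $\beta : G \rightarrow A$, $\mathrm{d}(\beta) : \Gamma \times G \rightarrow A$ is $\mathrm{d}(\beta)(\sigma,\tau) = \beta(\bar\sigma)\,\sigma(\beta(\tau))\,\beta(\bar\sigma\tau)^{ -1}$; for $\gamma : G/N \rightarrow A$, $\mathrm{d}(\gamma) : \Gamma \times G/N \rightarrow A$ is $\mathrm{d}(\gamma)(\sigma,\tau) = \gamma(\dot\sigma)\,\sigma(\gamma(\tau))\,\gamma(\dot\sigma\tau)^{ -1}$,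 where $\dot\sigma$ is the image of $\sigma$ in $G/N$. -}

module Defs where

open import Level using (Level; _⊔_)
open import Algebra.Bundles using (Group; AbelianGroup)
open import Algebra.Morphism.Structures using (module GroupMorphisms)
open import Data.List using (List; foldr; map)
open import Data.List.Relation.Unary.Any using (Any)
open import Data.List.Relation.Unary.AllPairs using (AllPairs)
open import Data.Product using (∃)
open import Relation.Nullary using (¬_)

private variable c ℓ c' ℓ' a ℓa : Level

record IsFiniteGroup (G : Group c ℓ) : Set (c ⊔ ℓ) where
  open Group G
  field
    elements : List Carrier
    complete : ∀ g → Any (g ≈_) elements

module _ (G : Group c ℓ) where
  open Group G

  _∈ₗ_ : Carrier → List Carrier → Set (c ⊔ ℓ)
  x ∈ₗ xs = Any (x ≈_) xs

  record IsNormalSubgroupList (Nl : List Carrier) : Set (c ⊔ ℓ) where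
    field
      distinct : AllPairs (λ x y → ¬ (x ≈ y)) Nl
      ε∈       : ε ∈ₗ Nl
      ∙∈       : ∀ {x y} → x ∈ₗ Nl → y ∈ₗ Nl → (x ∙ y) ∈ₗ Nl
      ⁻¹∈      : ∀ {x} → x ∈ₗ Nl → (x ⁻¹) ∈ₗ Nl
      conj∈    : ∀ g {x} → x ∈ₗ Nl → ((g ∙ x) ∙ g ⁻¹) ∈ₗ Nl

module _ (Γ : Group c' ℓ') (G : Group c ℓ) where
  private
    module Γ = Group Γ
    module G = Group G

  record IsSurjectiveMorphism (ρ : Γ.Carrier → G.Carrier) : Set (c ⊔ ℓ ⊔ c' ⊔ ℓ') where
    field
      isHom      : GroupMorphisms.IsGroupHomomorphism Γ.rawGroup G.rawGroup ρ
      surjective : ∀ g → ∃ λ σ → ρ σ G.≈ g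

module _ (Γ : Group c' ℓ') (A : AbelianGroup a ℓa) where
  private
    module Γ = Group Γ
    module A = AbelianGroup A

  record IsGammaModule (act : Γ.Carrier → A.Carrier → A.Carrier) : Set (c' ⊔ ℓ' ⊔ a ⊔ ℓa) where
    field
      act-cong : ∀ {σ τ x y} → σ Γ.≈ τ → x A.≈ y → act σ x A.≈ act τ y
      act-ε    : ∀ x → act Γ.ε x A.≈ x
      act-∙    : ∀ σ τ x → act (σ Γ.∙ τ) x A.≈ act σ (act τ x)
      act-hom  : ∀ σ x y → act σ (x A.∙ y) A.≈ (act σ x A.∙ act σ y)

-- The maps AW¹, AW², d.  Elements of G/N are represented by their lifts in G:
-- a map G/N → A is recorded as a map G → A (evaluated at a chosen lift).
module AW (G : Group c ℓ) (Γ : Group c' ℓ') (A : AbelianGroup a ℓa)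
          (ρ : Group.Carrier Γ → Group.Carrier G)
          (act : Group.Carrier Γ → AbelianGroup.Carrier A → AbelianGroup.Carrier A)
          (Nl : List (Group.Carrier G)) where
  private
    module Γ = Group Γ
    module G = Group G
    module A = AbelianGroup A

  ∏N : (G.Carrier → A.Carrier) → A.Carrier
  ∏N f = foldr A._∙_ A.ε (map f Nl)

  AW¹ : (G.Carrier → A.Carrier) → (G.Carrier → A.Carrier)
  AW¹ β σ̃ = ∏N (λ n → β (n G.∙ σ̃) A.∙ (β n) A.⁻¹)

  AW² : (Γ.Carrier → G.Carrier → A.Carrier) → (Γ.Carrier → G.Carrier → A.Carrier)
  AW² α σ τ̃ = ∏N (λ n → α σ (n G.∙ τ̃) A.∙ (α σ n) A.⁻¹)

  d : (G.Carrier → A.Carrier) → (Γ.Carrier → G.Carrier → A.Carrier)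
  d β σ τ = (β (ρ σ) A.∙ act σ (β τ)) A.∙ (β (ρ σ G.∙ τ)) A.⁻¹

  d/N : (G.Carrier → A.Carrier) → (Γ.Carrier → G.Carrier → A.Carrier)
  d/N γ σ τ̃ = (γ (ρ σ) A.∙ act σ (γ τ̃)) A.∙ (γ (ρ σ G.∙ τ̃)) A.⁻¹

{-# OPTIONS --safe #-}
-- Write s = σ̄. Since A is abelian and σ acts by automorphisms, both sides collapse into
-- products over n ∈ N: the left side becomes ∏ β(ns)/β(nsτ) · ∏ σ(β(nτ)/β(n)), the right side
-- ∏ β(sn)/β(snτ) · ∏ σ(β(nτ)/β(n)). The first factors agree because n ↦ s n s⁻¹ permutes the
-- normal subgroup N and sends ns to sn and n(sτ) to s(nτ).
module Submission where

open import Defs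
open import Level using (Level)
open import Algebra.Bundles using (Group; AbelianGroup; CommutativeMonoid)
open import Data.List using (List; []; _∷_; foldr; map)
open import Data.List.Properties using (map-∘)
open import Data.List.Relation.Unary.Any using (here; there)
open import Data.List.Relation.Unary.AllPairs as AllPairs using (_∷_)
import Data.List.Membership.Setoid as Membership
open import Data.List.Membership.Setoid.Properties using (∈-resp-≈; All[≉]⇒∉; ∈-map⁺; ∈-map⁻)
import Data.List.Relation.Unary.Unique.Setoid as UniqueSetoid
import Data.List.Relation.Unary.Unique.Setoid.Properties as Unique
import Data.List.Relation.Binary.Subset.Setoid as Subset
import Data.List.Relation.Binary.Permutation.Setoid as Permutation
import Data.List.Relation.Binary.Permutation.Setoid.Properties as PermutationProperties
open import Data.Product using (_,_)
open import Function using (_∘_)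
open import Relation.Binary.Bundles using (Setoid)
open import Relation.Binary.Core using (_Preserves_⟶_)
open import Relation.Binary.PropositionalEquality as ≡ using (_≡_)
open import Relation.Nullary using (¬_; contradiction)
import Relation.Binary.Reasoning.Setoid as ≈-Reasoning
import Algebra.Properties.Group as GroupProperties
import Algebra.Properties.AbelianGroup as AbelianGroupProperties
import Algebra.Properties.CommutativeSemigroup as CommutativeSemigroupProperties

module UniquePermutation {c ℓ} (S : Setoid c ℓ) where
  open Setoid S
  open Membership S using (_∈_; _─_)
  open UniqueSetoid S using (Unique)
  open Subset S using (_⊆_)
  open Permutation S hiding (refl; trans)
  open PermutationProperties S using (∈-resp-↭; Unique-resp-↭)

  ↭-∷-─ : ∀ {x ys} (x∈ys : x ∈ ys) → ys ↭ x ∷ (ys ─ x∈ys)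
  ↭-∷-─ (here x≈y) = prep (sym x≈y) ↭-refl
  ↭-∷-─ {ys = y ∷ _} (there x∈ys) = ↭-trans (↭-prep y (↭-∷-─ x∈ys)) (↭-swap y _ ↭-refl)

  ∈-∷⇒∈-tail : ∀ {x z zs ws} → ¬ x ∈ ws → z ∈ ws → z ∈ x ∷ zs → z ∈ zs
  ∈-∷⇒∈-tail x∉ws z∈ws (here z≈x) = contradiction (∈-resp-≈ S z≈x z∈ws) x∉ws
  ∈-∷⇒∈-tail _ _ (there z∈zs) = z∈zs

  unique-⊆-⊇⇒↭ : ∀ {xs ys} → Unique xs → Unique ys → xs ⊆ ys → ys ⊆ xs → xs ↭ ys
  unique-⊆-⊇⇒↭ {[]} {[]} _ _ _ _ = ↭-refl
  unique-⊆-⊇⇒↭ {[]} {_ ∷ _} _ _ _ ys⊆[] with ys⊆[] (here refl)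
  ... | ()
  unique-⊆-⊇⇒↭ {x ∷ xs} {ys} (x≉xs ∷ xs!) ys! xs⊆ys ys⊆xs =
    ↭-trans (↭-prep x (unique-⊆-⊇⇒↭ xs! (AllPairs.tail x∷ys′!) xs⊆ys′ ys′⊆xs)) (↭-sym ys↭x∷ys′)
    where
      x∈ys : x ∈ ys
      x∈ys = xs⊆ys (here refl)
      ys↭x∷ys′ : ys ↭ x ∷ (ys ─ x∈ys)
      ys↭x∷ys′ = ↭-∷-─ x∈ys
      x∷ys′! : Unique (x ∷ (ys ─ x∈ys))
      x∷ys′! = Unique-resp-↭ ys↭x∷ys′ ys!
      xs⊆ys′ : xs ⊆ ys ─ x∈ys
      xs⊆ys′ z∈xs = ∈-∷⇒∈-tail (All[≉]⇒∉ S x≉xs) z∈xs (∈-resp-↭ ys↭x∷ys′ (xs⊆ys (there z∈xs)))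
      ys′⊆xs : ys ─ x∈ys ⊆ xs
      ys′⊆xs z∈ys′ = ∈-∷⇒∈-tail (All[≉]⇒∉ S (AllPairs.head x∷ys′!)) z∈ys′
                       (ys⊆xs (∈-resp-↭ (↭-sym ys↭x∷ys′) (there z∈ys′)))

module ListProduct {a ℓ} (M : CommutativeMonoid a ℓ) where
  open CommutativeMonoid M
  open CommutativeSemigroupProperties commutativeSemigroup using (interchange)

  ∏ : ∀ {x} {X : Set x} → (X → Carrier) → List X → Carrier
  ∏ f xs = foldr _∙_ ε (map f xs)

  module _ {x} {X : Set x} where

    ∏-cong : ∀ {f g : X → Carrier} → (∀ n → f n ≈ g n) → ∀ xs → ∏ f xs ≈ ∏ g xs
    ∏-cong f≈g [] = refl
    ∏-cong f≈g (n ∷ xs) = ∙-cong (f≈g n) (∏-cong f≈g xs)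

    ∏-distrib-∙ : ∀ (f g : X → Carrier) xs → ∏ (λ n → f n ∙ g n) xs ≈ ∏ f xs ∙ ∏ g xs
    ∏-distrib-∙ f g [] = sym (identityˡ ε)
    ∏-distrib-∙ f g (n ∷ xs) = trans (∙-congˡ (∏-distrib-∙ f g xs)) (interchange _ _ _ _)

    ∏-homo : ∀ (h : Carrier → Carrier) → h ε ≈ ε → (∀ u v → h (u ∙ v) ≈ h u ∙ h v) →
             ∀ (f : X → Carrier) xs → h (∏ f xs) ≈ ∏ (h ∘ f) xs
    ∏-homo h h-ε h-∙ f [] = h-ε
    ∏-homo h h-ε h-∙ f (n ∷ xs) = trans (h-∙ _ _) (∙-congˡ (∏-homo h h-ε h-∙ f xs))

    ∏-map : ∀ {y} {Y : Set y} (f : X → Carrier) (g : Y → X) ys → ∏ f (map g ys) ≡ ∏ (f ∘ g) ys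
    ∏-map f g ys = ≡.cong (foldr _∙_ ε) (≡.sym (map-∘ ys))

  module _ {c ℓ′} (S : Setoid c ℓ′) where
    open Permutation S using (_↭_)

    ∏-↭ : ∀ {f} → f Preserves Setoid._≈_ S ⟶ _≈_ → ∀ {xs ys} → xs ↭ ys → ∏ f xs ≈ ∏ f ys
    ∏-↭ f-cong xs↭ys =
      PermutationProperties.foldr-commMonoid setoid isCommutativeMonoid
        (PermutationProperties.map⁺ S setoid f-cong xs↭ys)

module AbelianGroupLemmas {a ℓ} (A : AbelianGroup a ℓ) where
  open AbelianGroup A
  open AbelianGroupProperties A using (ε⁻¹≈ε; ⁻¹-∙-comm; ⁻¹-involutive)
  open CommutativeSemigroupProperties commutativeSemigroup using (interchange)
  open ≈-Reasoning setoid
  open ListProduct commutativeMonoid public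

  x∙y-z∙w≈[x-z]∙[y-w] : ∀ x y z w → (x ∙ y) - (z ∙ w) ≈ (x - z) ∙ (y - w)
  x∙y-z∙w≈[x-z]∙[y-w] x y z w = begin
    (x ∙ y) ∙ (z ∙ w) ⁻¹       ≈⟨ ∙-congˡ (⁻¹-∙-comm z w) ⟨
    (x ∙ y) ∙ (z ⁻¹ ∙ w ⁻¹)    ≈⟨ interchange x y (z ⁻¹) (w ⁻¹) ⟩
    (x ∙ z ⁻¹) ∙ (y ∙ w ⁻¹)    ∎

  x∙z-y∙z≈x-y : ∀ x y z → (x ∙ z) - (y ∙ z) ≈ x - y
  x∙z-y∙z≈x-y x y z = begin
    (x ∙ z) - (y ∙ z)          ≈⟨ x∙y-z∙w≈[x-z]∙[y-w] x z y z ⟩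
    (x - y) ∙ (z - z)          ≈⟨ ∙-congˡ (inverseʳ z) ⟩
    (x - y) ∙ ε                ≈⟨ identityʳ (x - y) ⟩
    x - y                      ∎

  [x-y]-[x-z]≈z-y : ∀ x y z → (x - y) - (x - z) ≈ z - y
  [x-y]-[x-z]≈z-y x y z = begin
    (x ∙ y ⁻¹) - (x ∙ z ⁻¹)    ≈⟨ x∙y-z∙w≈[x-z]∙[y-w] x (y ⁻¹) x (z ⁻¹) ⟩
    (x - x) ∙ (y ⁻¹ - z ⁻¹)    ≈⟨ ∙-cong (inverseʳ x) (∙-congˡ (⁻¹-involutive z)) ⟩
    ε ∙ (y ⁻¹ ∙ z)             ≈⟨ identityˡ (y ⁻¹ ∙ z) ⟩
    y ⁻¹ ∙ z                   ≈⟨ comm (y ⁻¹) z ⟩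
    z - y                      ∎

  ∏-distrib‿- : ∀ {x} {X : Set x} (f g : X → Carrier) xs → ∏ (λ n → f n - g n) xs ≈ ∏ f xs - ∏ g xs
  ∏-distrib‿- f g xs = begin
    ∏ (λ n → f n - g n) xs     ≈⟨ ∏-distrib-∙ f (_⁻¹ ∘ g) xs ⟩
    ∏ f xs ∙ ∏ (_⁻¹ ∘ g) xs    ≈⟨ ∙-congˡ (∏-homo _⁻¹ ε⁻¹≈ε (λ u v → sym (⁻¹-∙-comm u v)) g xs) ⟨
    ∏ f xs - ∏ g xs            ∎

module GammaModuleLemmas {c′ ℓ′ a ℓa} {Γ : Group c′ ℓ′} {A : AbelianGroup a ℓa}
    {act : Group.Carrier Γ → AbelianGroup.Carrier A → AbelianGroup.Carrier A}
    (isGammaModule : IsGammaModule Γ A act) where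
  open AbelianGroup A
  open AbelianGroupProperties A using (identityˡ-unique; inverseˡ-unique)
  open AbelianGroupLemmas A using (∏; ∏-homo)
  open IsGammaModule isGammaModule

  act-homo-ε : ∀ σ → act σ ε ≈ ε
  act-homo-ε σ = identityˡ-unique (act σ ε) (act σ ε)
    (trans (sym (act-hom σ ε ε)) (act-cong (Group.refl Γ) (identityˡ ε)))

  act-homo-⁻¹ : ∀ σ x → act σ (x ⁻¹) ≈ act σ x ⁻¹
  act-homo-⁻¹ σ x = inverseˡ-unique (act σ (x ⁻¹)) (act σ x)
    (trans (sym (act-hom σ (x ⁻¹) x)) (trans (act-cong (Group.refl Γ) (inverseˡ x)) (act-homo-ε σ)))

  act-homo‿- : ∀ σ x y → act σ (x - y) ≈ act σ x - act σ y
  act-homo‿- σ x y = trans (act-hom σ x (y ⁻¹)) (∙-congˡ (act-homo-⁻¹ σ y))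

  act-homo-∏ : ∀ {x} {X : Set x} σ (f : X → Carrier) xs → act σ (∏ f xs) ≈ ∏ (act σ ∘ f) xs
  act-homo-∏ σ = ∏-homo (act σ) (act-homo-ε σ) (act-hom σ)

module Conjugation {c ℓ} (G : Group c ℓ) where
  open Group G
  open GroupProperties G using (⁻¹-involutive; ∙-cancelˡ; ∙-cancelʳ; //-rightDividesˡ; //-rightDividesʳ; \\-leftDividesˡ)
  open ≈-Reasoning setoid
  open Permutation setoid using (_↭_)
  open UniquePermutation setoid using (unique-⊆-⊇⇒↭)

  conjugate : Carrier → Carrier → Carrier
  conjugate g n = (g ∙ n) ∙ g ⁻¹

  conjugate-cong : ∀ g {m n} → m ≈ n → conjugate g m ≈ conjugate g n
  conjugate-cong g m≈n = ∙-congʳ (∙-congˡ m≈n)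

  conjugate-injective : ∀ g {m n} → conjugate g m ≈ conjugate g n → m ≈ n
  conjugate-injective g {m} {n} eq = ∙-cancelˡ g m n (∙-cancelʳ (g ⁻¹) (g ∙ m) (g ∙ n) eq)

  gng⁻¹∙g≈gn : ∀ g n → conjugate g n ∙ g ≈ g ∙ n
  gng⁻¹∙g≈gn g n = //-rightDividesˡ g (g ∙ n)

  gng⁻¹∙gh≈g∙nh : ∀ g n h → conjugate g n ∙ (g ∙ h) ≈ g ∙ (n ∙ h)
  gng⁻¹∙gh≈g∙nh g n h = begin
    conjugate g n ∙ (g ∙ h)   ≈⟨ assoc (conjugate g n) g h ⟨
    (conjugate g n ∙ g) ∙ h   ≈⟨ ∙-congʳ (gng⁻¹∙g≈gn g n) ⟩
    (g ∙ n) ∙ h               ≈⟨ assoc g n h ⟩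
    g ∙ (n ∙ h)               ∎

  conjugate-⁻¹ : ∀ g n → conjugate g (conjugate (g ⁻¹) n) ≈ n
  conjugate-⁻¹ g n = begin
    conjugate g ((g ⁻¹ ∙ n) ∙ g ⁻¹ ⁻¹)   ≈⟨ conjugate-cong g (∙-congˡ (⁻¹-involutive g)) ⟩
    (g ∙ ((g ⁻¹ ∙ n) ∙ g)) ∙ g ⁻¹         ≈⟨ ∙-congʳ (assoc g (g ⁻¹ ∙ n) g) ⟨
    ((g ∙ (g ⁻¹ ∙ n)) ∙ g) ∙ g ⁻¹         ≈⟨ //-rightDividesʳ g (g ∙ (g ⁻¹ ∙ n)) ⟩
    g ∙ (g ⁻¹ ∙ n)                        ≈⟨ \\-leftDividesˡ g n ⟩
    n                                     ∎

  map-conjugate-↭ : ∀ {Nl} → IsNormalSubgroupList G Nl → ∀ g → map (conjugate g) Nl ↭ Nl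
  map-conjugate-↭ N g =
    unique-⊆-⊇⇒↭ (Unique.map⁺ setoid setoid (conjugate-injective g) distinct) distinct
      (λ z∈gNg⁻¹ → let n , n∈N , z≈gng⁻¹ = ∈-map⁻ setoid setoid z∈gNg⁻¹
                   in ∈-resp-≈ setoid (sym z≈gng⁻¹) (conj∈ g n∈N))
      (λ z∈N → ∈-resp-≈ setoid (conjugate-⁻¹ g _)
                 (∈-map⁺ setoid setoid (conjugate-cong g) (conj∈ (g ⁻¹) z∈N)))
    where open IsNormalSubgroupList N

module Proposition {c ℓ c′ ℓ′ a ℓa : Level}
    (G : Group c ℓ) (Nl : List (Group.Carrier G)) (N : IsNormalSubgroupList G Nl)
    (Γ : Group c′ ℓ′) (ρ : Group.Carrier Γ → Group.Carrier G)
    (A : AbelianGroup a ℓa) (act : Group.Carrier Γ → AbelianGroup.Carrier A → AbelianGroup.Carrier A)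
    (isGammaModule : IsGammaModule Γ A act)
    (β : Group.Carrier G → AbelianGroup.Carrier A)
    (β-cong : ∀ {x y} → Group._≈_ G x y → AbelianGroup._≈_ A (β x) (β y)) where
  private
    module G = Group G
    module Γ = Group Γ
  open AbelianGroup A
  open AbelianGroupProperties A using (//-cong₂)
  open CommutativeSemigroupProperties commutativeSemigroup using (xy∙z≈xz∙y)
  open AbelianGroupLemmas A
  open GammaModuleLemmas isGammaModule using (act-homo‿-; act-homo-∏)
  open Conjugation G using (conjugate; map-conjugate-↭; gng⁻¹∙g≈gn; gng⁻¹∙gh≈g∙nh)
  open AW G Γ A ρ act Nl
  open ≈-Reasoning setoid

  ∏-right-quotients : G.Carrier → G.Carrier → Carrier
  ∏-right-quotients s t = ∏ (λ n → β (n G.∙ s) - β (n G.∙ (s G.∙ t))) Nl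

  ∏-left-quotients : G.Carrier → G.Carrier → Carrier
  ∏-left-quotients s t = ∏ (λ n → β (s G.∙ n) - β (s G.∙ (n G.∙ t))) Nl

  ∏-acted-quotients : Γ.Carrier → G.Carrier → Carrier
  ∏-acted-quotients σ t = ∏ (λ n → act σ (β (n G.∙ t) - β n)) Nl

  AW¹-quotient : ∀ x y → AW¹ β x - AW¹ β y ≈ ∏ (λ n → β (n G.∙ x) - β (n G.∙ y)) Nl
  AW¹-quotient x y = begin
    AW¹ β x - AW¹ β y
      ≈⟨ ∏-distrib‿- _ _ Nl ⟨
    ∏ (λ n → (β (n G.∙ x) - β n) - (β (n G.∙ y) - β n)) Nl
      ≈⟨ ∏-cong (λ n → x∙z-y∙z≈x-y (β (n G.∙ x)) (β (n G.∙ y)) (β n ⁻¹)) Nl ⟩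
    ∏ (λ n → β (n G.∙ x) - β (n G.∙ y)) Nl ∎

  d/N-AW¹ : ∀ σ t → d/N (AW¹ β) σ t ≈ ∏-right-quotients (ρ σ) t ∙ ∏-acted-quotients σ t
  d/N-AW¹ σ t = begin
    (AW¹ β s ∙ act σ (AW¹ β t)) - AW¹ β (s G.∙ t)  ≈⟨ xy∙z≈xz∙y _ _ _ ⟩
    (AW¹ β s - AW¹ β (s G.∙ t)) ∙ act σ (AW¹ β t)  ≈⟨ ∙-cong (AW¹-quotient s (s G.∙ t)) (act-homo-∏ σ _ Nl) ⟩
    ∏-right-quotients s t ∙ ∏-acted-quotients σ t  ∎
    where
      s : G.Carrier
      s = ρ σ

  d-quotient : ∀ σ t n →
    d β σ (n G.∙ t) - d β σ n ≈ (β (ρ σ G.∙ n) - β (ρ σ G.∙ (n G.∙ t))) ∙ act σ (β (n G.∙ t) - β n)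
  d-quotient σ t n = begin
    ((β s ∙ act σ (β (n G.∙ t))) - β (s G.∙ (n G.∙ t))) - ((β s ∙ act σ (β n)) - β (s G.∙ n))
      ≈⟨ //-cong₂ (xy∙z≈xz∙y _ _ _) (xy∙z≈xz∙y _ _ _) ⟩
    ((β s - β (s G.∙ (n G.∙ t))) ∙ act σ (β (n G.∙ t))) - ((β s - β (s G.∙ n)) ∙ act σ (β n))
      ≈⟨ x∙y-z∙w≈[x-z]∙[y-w] _ _ _ _ ⟩
    ((β s - β (s G.∙ (n G.∙ t))) - (β s - β (s G.∙ n))) ∙ (act σ (β (n G.∙ t)) - act σ (β n))
      ≈⟨ ∙-cong ([x-y]-[x-z]≈z-y _ _ _) (sym (act-homo‿- σ _ _)) ⟩
    (β (s G.∙ n) - β (s G.∙ (n G.∙ t))) ∙ act σ (β (n G.∙ t) - β n) ∎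
    where
      s : G.Carrier
      s = ρ σ

  AW²-d : ∀ σ t → AW² (d β) σ t ≈ ∏-left-quotients (ρ σ) t ∙ ∏-acted-quotients σ t
  AW²-d σ t = trans (∏-cong (d-quotient σ t) Nl) (∏-distrib-∙ _ _ Nl)

  ∏-right≈∏-left-quotients : ∀ s t → ∏-right-quotients s t ≈ ∏-left-quotients s t
  ∏-right≈∏-left-quotients s t = begin
    ∏ f Nl                       ≈⟨ ∏-↭ G.setoid f-cong (map-conjugate-↭ N s) ⟨
    ∏ f (map (conjugate s) Nl)   ≡⟨ ∏-map f (conjugate s) Nl ⟩
    ∏ (f ∘ conjugate s) Nl       ≈⟨ ∏-cong (λ n → //-cong₂ (β-cong (gng⁻¹∙g≈gn s n))
                                                            (β-cong (gng⁻¹∙gh≈g∙nh s n t))) Nl ⟩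
    ∏-left-quotients s t         ∎
    where
      f : G.Carrier → Carrier
      f n = β (n G.∙ s) - β (n G.∙ (s G.∙ t))
      f-cong : ∀ {m n} → m G.≈ n → f m ≈ f n
      f-cong m≈n = //-cong₂ (β-cong (G.∙-congʳ m≈n)) (β-cong (G.∙-congʳ m≈n))

proposition3p5 : ∀ {c ℓ c' ℓ' a ℓa : Level}
    (G : Group c ℓ) → IsFiniteGroup G →
    (Nl : List (Group.Carrier G)) → IsNormalSubgroupList G Nl →
    (Γ : Group c' ℓ') (ρ : Group.Carrier Γ → Group.Carrier G) → IsSurjectiveMorphism Γ G ρ →
    (A : AbelianGroup a ℓa) (act : Group.Carrier Γ → AbelianGroup.Carrier A → AbelianGroup.Carrier A) →
    IsGammaModule Γ A act →
    (β : Group.Carrier G → AbelianGroup.Carrier A) →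
    (∀ {x y} → Group._≈_ G x y → AbelianGroup._≈_ A (β x) (β y)) →
    ∀ (σ : Group.Carrier Γ) (τ̃ : Group.Carrier G) →
    AbelianGroup._≈_ A
      (AW.d/N G Γ A ρ act Nl (AW.AW¹ G Γ A ρ act Nl β) σ τ̃)
      (AW.AW² G Γ A ρ act Nl (AW.d G Γ A ρ act Nl β) σ τ̃)
proposition3p5 G _ Nl N Γ ρ _ A act isGammaModule β β-cong σ τ̃ = begin
  d/N (AW¹ β) σ τ̃                                       ≈⟨ d/N-AW¹ σ τ̃ ⟩
  ∏-right-quotients (ρ σ) τ̃ ∙ ∏-acted-quotients σ τ̃   ≈⟨ ∙-congʳ (∏-right≈∏-left-quotients (ρ σ) τ̃) ⟩
  ∏-left-quotients (ρ σ) τ̃ ∙ ∏-acted-quotients σ τ̃    ≈⟨ AW²-d σ τ̃ ⟨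
  AW² (d β) σ τ̃                                         ∎
  where
    open AbelianGroup A using (setoid; _∙_; ∙-congʳ)
    open ≈-Reasoning setoid
    open AW G Γ A ρ act Nl
    open Proposition G Nl N Γ ρ A act isGammaModule β β-cong
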